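{- Let $P$ be a finite poset and $\sigma:P\to P$ an anti-automorphism. If $\sigma^2$ is not the identity map, then $P$ is $1/3$-balanced.
   Context: An anti-automorphism of a poset $P$ is a bijection $\sigma:P\to P$ such that $x\le_P y$ if and only if $\sigma(y)\le_P\sigma(x)$. For distinct $x,y\in P$, $\mathbb{P}(x\prec y)$ is the proportion of linear extensions of $P$ (total orders of $P$ compatible with $\le_P$) in which $x$ comes before $y$. $P$ is $1/3$-balanced if there are distinct $x,y\in P$ with $1/3\le\mathbb{P}(x\prec y)\le 2/3$. -}

module Defs where

open import Data.Nat using (ℕ; zero; suc; _*_; _≤_; _<_)
import Data.Nat.Properties as ℕₚ
open import Data.Fin using (Fin; toℕ)
open import Data.Fin.Properties using (all?; _≟_)
open import Data.Vec using (Vec; []; _∷_; lookup)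
open import Data.List using (List; []; _∷_; filter; length; cartesianProductWith; allFin)
open import Data.Product using (_×_; _,_; Σ; ∃-syntax)
open import Relation.Binary.Core using (Rel)
open import Relation.Binary.Structures using (IsDecPartialOrder)
open import Relation.Binary.PropositionalEquality using (_≡_; _≢_)
open import Relation.Nullary using (Dec; yes; no; ¬_)
open import Relation.Nullary.Decidable using (_×-dec_; _→-dec_)
open import Function.Bundles using (_⇔_)
open import Function.Definitions using (Bijective)

record FinPoset (n : ℕ) : Set₁ where
  field
    _≼_ : Rel (Fin n) _
    isDecPartialOrder : IsDecPartialOrder _≡_ _≼_
  open IsDecPartialOrder isDecPartialOrder public using (_≤?_)

open FinPoset public

allVecs : (n m : ℕ) → List (Vec (Fin m) n)
allVecs zero m = [] ∷ []
allVecs (suc n) m = cartesianProductWith _∷_ (allFin m) (allVecs n m)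

-- A linear extension of P, given by the position of each element:
-- a bijection pos : Fin n → Fin n (injective suffices on Fin n) with
-- x ≼ y ⇒ pos x ≤ pos y.
IsLinExt : ∀ {n} → FinPoset n → Vec (Fin n) n → Set
IsLinExt {n} P v =
  (∀ x y → lookup v x ≡ lookup v y → x ≡ y) ×
  (∀ x y → _≼_ P x y → toℕ (lookup v x) ≤ toℕ (lookup v y))

isLinExt? : ∀ {n} (P : FinPoset n) (v : Vec (Fin n) n) → Dec (IsLinExt P v)
isLinExt? P v =
  all? (λ x → all? (λ y → (lookup v x ≟ lookup v y) →-dec (x ≟ y)))
  ×-dec
  all? (λ x → all? (λ y → _≤?_ P x y →-dec (toℕ (lookup v x) ℕₚ.≤? toℕ (lookup v y))))

linExts : ∀ {n} → FinPoset n → List (Vec (Fin n) n)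
linExts {n} P = filter (isLinExt? P) (allVecs n n)

numLinExt : ∀ {n} → FinPoset n → ℕ
numLinExt P = length (linExts P)

numBefore : ∀ {n} → FinPoset n → Fin n → Fin n → ℕ
numBefore P x y =
  length (filter (λ v → toℕ (lookup v x) ℕₚ.<? toℕ (lookup v y)) (linExts P))

-- 1/3 ≤ ℙ(x ≺ y) ≤ 2/3, i.e. 1/3 ≤ numBefore/numLinExt ≤ 2/3, cross-multiplied.
BalancedPair : ∀ {n} → FinPoset n → Fin n → Fin n → Set
BalancedPair P x y =
  numLinExt P ≤ 3 * numBefore P x y × 3 * numBefore P x y ≤ 2 * numLinExt P

OneThirdBalanced : ∀ {n} → FinPoset n → Set
OneThirdBalanced {n} P = ∃[ x ] ∃[ y ] (x ≢ y × BalancedPair P x y)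

IsAntiAutomorphism : ∀ {n} → FinPoset n → (Fin n → Fin n) → Set
IsAntiAutomorphism P σ =
  Bijective _≡_ _≡_ σ × (∀ x y → (_≼_ P x y ⇔ _≼_ P (σ y) (σ x)))

-- Suppose P is not 1/3-balanced. Then for x ≠ y one of ℙ(x ≺ y), ℙ(y ≺ x) exceeds
-- 2/3, and the relation "ℙ(x ≺ y) > 2/3" is a strict total order on P: it is
-- transitive because ℙ(x ≺ y) + ℙ(y ≺ z) ≤ ℙ(x ≺ z) + 1. An automorphism permutes
-- the linear extensions, so it preserves this order, and an order-preserving
-- permutation of a finite chain is the identity. Hence the automorphism σ² is the
-- identity.
module Submission where

open import Defs
open import Data.Nat.Tactic.RingSolver using (solve-∀)
open import Data.Nat using (ℕ; zero; suc; _+_; _*_; _≤_; _<_; z≤n)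
open import Data.Nat.Properties as ℕₚ using (≤-refl; n≮0; m≤n+m; <⇒≤; ≰⇒>)
open import Algebra.Properties.CommutativeSemigroup ℕₚ.+-commutativeSemigroup using (interchange)
open import Data.Fin using (Fin; toℕ)
open import Data.Fin.Properties using (_≟_; any?; pigeonhole; injective⇒≤; toℕ-injective)
open import Data.Vec using (Vec; []; _∷_; lookup; tabulate)
import Data.Vec.Properties as Vecₚ
open import Data.List using (List; []; _∷_; length; filter; map)
import Data.List as List
open import Data.List.Properties using (length-map; filter-none)
open import Data.List.Membership.Propositional using (_∈_)
open import Data.List.Membership.Propositional.Properties
  using (∈-lookup; ∈-map⁻; ∈-filter⁺; ∈-filter⁻; ∈-allFin; ∈-cartesianProductWith⁺)
open import Data.List.Relation.Binary.Subset.Propositional using (_⊆_)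
open import Data.List.Relation.Unary.All as All using (All; []; _∷_)
open import Data.List.Relation.Unary.All.Properties using (all-filter)
open import Data.List.Relation.Unary.AllPairs using ([]; _∷_)
open import Data.List.Relation.Unary.Any using (here; index)
open import Data.List.Relation.Unary.Any.Properties using (lookup-index)
open import Data.List.Relation.Unary.Unique.Propositional using (Unique)
import Data.List.Relation.Unary.Unique.Propositional.Properties as Uniqueₚ
open import Data.Product using (_,_; proj₁; proj₂)
open import Data.Sum using (_⊎_; inj₁; inj₂; [_,_]′)
open import Function.Base using (_∘_; flip)
open import Function.Bundles using (_⇔_; mk⇔; Equivalence)
open import Function.Consequences.Propositional using (surjective⇒strictlySurjective)
import Function.Construct.Composition as Compose
open import Function.Definitions using (Bijective)
open import Level using (0ℓ)
open import Relation.Binary.PropositionalEquality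
  using (_≡_; _≢_; refl; sym; trans; cong; cong₂; subst; subst₂; module ≡-Reasoning)
open import Relation.Nullary using (¬_; Dec; yes; no; contradiction; ¬?)
open import Relation.Nullary.Decidable using (_×-dec_; decidable-stable)
open import Relation.Unary using (Pred; Decidable)

module _ {A : Set} where

  count : {P : Pred A 0ℓ} → Decidable P → List A → ℕ
  count P? xs = length (filter P? xs)

  indicator : {P : Set} → Dec P → ℕ
  indicator (yes _) = 1
  indicator (no _)  = 0

  count-∷ : {P : Pred A 0ℓ} (P? : Decidable P) (x : A) (xs : List A) →
            count P? (x ∷ xs) ≡ indicator (P? x) + count P? xs
  count-∷ P? x xs with P? x
  ... | yes _ = refl
  ... | no _  = refl

  module _ {P Q : Pred A 0ℓ} (P? : Decidable P) (Q? : Decidable Q) where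

    indicator-complement : ∀ {x} → (Q x ⇔ (¬ P x)) → indicator (P? x) + indicator (Q? x) ≡ 1
    indicator-complement {x} Q⇔¬P with P? x | Q? x
    ... | yes p  | yes q  = contradiction p (Equivalence.to Q⇔¬P q)
    ... | yes _  | no _   = refl
    ... | no _   | yes _  = refl
    ... | no ¬p  | no ¬q  = contradiction (Equivalence.from Q⇔¬P ¬p) ¬q

    count-complement : ∀ {xs} → All (λ x → Q x ⇔ (¬ P x)) xs →
                       count P? xs + count Q? xs ≡ length xs
    count-complement {[]}     []         = refl
    count-complement {x ∷ xs} (Q⇔¬P ∷ hs) = begin
      count P? (x ∷ xs) + count Q? (x ∷ xs)
        ≡⟨ cong₂ _+_ (count-∷ P? x xs) (count-∷ Q? x xs) ⟩
      (indicator (P? x) + count P? xs) + (indicator (Q? x) + count Q? xs)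
        ≡⟨ interchange (indicator (P? x)) (count P? xs) (indicator (Q? x)) (count Q? xs) ⟩
      (indicator (P? x) + indicator (Q? x)) + (count P? xs + count Q? xs)
        ≡⟨ cong₂ _+_ (indicator-complement Q⇔¬P) (count-complement hs) ⟩
      suc (length xs) ∎
      where open ≡-Reasoning

    module _ {R : Pred A 0ℓ} (R? : Decidable R) (P∩Q⊆R : ∀ x → P x → Q x → R x) where

      indicator-∩ : ∀ x → indicator (P? x) + indicator (Q? x) ≤ indicator (R? x) + 1
      indicator-∩ x with P? x | Q? x | R? x
      ... | yes p | yes q | no ¬r = contradiction (P∩Q⊆R x p q) ¬r
      ... | yes _ | yes _ | yes _ = ≤-refl
      ... | yes _ | no _  | _     = m≤n+m 1 _
      ... | no _  | yes _ | _     = m≤n+m 1 _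
      ... | no _  | no _  | _     = z≤n

      count-∩ : ∀ xs → count P? xs + count Q? xs ≤ count R? xs + length xs
      count-∩ []       = z≤n
      count-∩ (x ∷ xs) = begin
        count P? (x ∷ xs) + count Q? (x ∷ xs)
          ≡⟨ cong₂ _+_ (count-∷ P? x xs) (count-∷ Q? x xs) ⟩
        (indicator (P? x) + count P? xs) + (indicator (Q? x) + count Q? xs)
          ≡⟨ interchange (indicator (P? x)) (count P? xs) (indicator (Q? x)) (count Q? xs) ⟩
        (indicator (P? x) + indicator (Q? x)) + (count P? xs + count Q? xs)
          ≤⟨ ℕₚ.+-mono-≤ (indicator-∩ x) (count-∩ xs) ⟩
        (indicator (R? x) + 1) + (count R? xs + length xs)
          ≡⟨ interchange (indicator (R? x)) 1 (count R? xs) (length xs) ⟩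
        (indicator (R? x) + count R? xs) + suc (length xs)
          ≡⟨ cong (_+ suc (length xs)) (count-∷ R? x xs) ⟨
        count R? (x ∷ xs) + length (x ∷ xs) ∎
        where open ℕₚ.≤-Reasoning

  unique⇒lookup-injective : ∀ {xs : List A} → Unique xs → ∀ {i j} →
                     List.lookup xs i ≡ List.lookup xs j → i ≡ j
  unique⇒lookup-injective (_ ∷ _)       {Fin.zero}  {Fin.zero}  _  = refl
  unique⇒lookup-injective (x∉xs ∷ _)    {Fin.zero}  {Fin.suc j} eq =
    contradiction eq (All.lookup x∉xs (∈-lookup j))
  unique⇒lookup-injective (x∉xs ∷ _)    {Fin.suc i} {Fin.zero}  eq =
    contradiction (sym eq) (All.lookup x∉xs (∈-lookup i))
  unique⇒lookup-injective (_ ∷ xs-uniq) {Fin.suc i} {Fin.suc j} eq =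
    cong Fin.suc (unique⇒lookup-injective xs-uniq eq)

  unique⊆⇒length≤ : ∀ {xs ys : List A} → Unique xs → xs ⊆ ys → length xs ≤ length ys
  unique⊆⇒length≤ {xs} {ys} xs-uniq xs⊆ys = injective⇒≤ position-injective
    where
    position : Fin (length xs) → Fin (length ys)
    position i = index (xs⊆ys (∈-lookup i))

    position-injective : ∀ {i j} → position i ≡ position j → i ≡ j
    position-injective {i} {j} eq = unique⇒lookup-injective xs-uniq (begin
      List.lookup xs i            ≡⟨ lookup-index (xs⊆ys (∈-lookup i)) ⟩
      List.lookup ys (position i) ≡⟨ cong (List.lookup ys) eq ⟩
      List.lookup ys (position j) ≡⟨ lookup-index (xs⊆ys (∈-lookup j)) ⟨
      List.lookup xs j            ∎)
      where open ≡-Reasoning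

no-ascending-orbit : ∀ {n} (Q : Fin n → Fin n → Set) → (∀ a → ¬ Q a a) →
                     (∀ {a b c} → Q a b → Q b c → Q a c) →
                     (ρ : Fin n → Fin n) → (∀ {a b} → Q a b → Q (ρ a) (ρ b)) →
                     ∀ x → ¬ Q x (ρ x)
no-ascending-orbit {n} Q Q-irrefl Q-trans ρ ρ-mono x x<ρx =
  let i , j , i<j , orbitᵢ≡orbitⱼ = pigeonhole (ℕₚ.n<1+n n) (orbit ∘ toℕ)
  in Q-irrefl _ (subst (Q _) (sym orbitᵢ≡orbitⱼ) (ascending i<j))
  where
  orbit : ℕ → Fin n
  orbit zero    = x
  orbit (suc k) = ρ (orbit k)

  step : ∀ k → Q (orbit k) (orbit (suc k))
  step zero    = x<ρx
  step (suc k) = ρ-mono (step k)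

  ascending : ∀ {i j} → i < j → Q (orbit i) (orbit j)
  ascending {i} {suc j} i<1+j with ℕₚ.m<1+n⇒m<n∨m≡n i<1+j
  ... | inj₁ i<j  = Q-trans (ascending i<j) (step j)
  ... | inj₂ refl = step i

complement-of-minority : ∀ u v N → u + v ≡ N → 3 * u < N → 2 * N < 3 * v
complement-of-minority u v N u+v≡N 3u<N = ℕₚ.+-cancelˡ-< (3 * u) (2 * N) (3 * v) (begin-strict
  3 * u + 2 * N   <⟨ ℕₚ.+-monoˡ-< (2 * N) 3u<N ⟩
  3 * N           ≡⟨ cong (3 *_) u+v≡N ⟨
  3 * (u + v)     ≡⟨ ℕₚ.*-distribˡ-+ 3 u v ⟩
  3 * u + 3 * v   ∎)
  where open ℕₚ.≤-Reasoning

majority-trans : ∀ u v w N → 2 * N < 3 * u → 2 * N < 3 * v → u + v ≤ w + N → N < 3 * w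
majority-trans u v w N 2N<3u 2N<3v u+v≤w+N = ℕₚ.+-cancelʳ-< (3 * N) N (3 * w) (begin-strict
  N + 3 * N       ≡⟨ N+3*N≡2*N+2*N N ⟩
  2 * N + 2 * N   <⟨ ℕₚ.+-mono-< 2N<3u 2N<3v ⟩
  3 * u + 3 * v   ≡⟨ ℕₚ.*-distribˡ-+ 3 u v ⟨
  3 * (u + v)     ≤⟨ ℕₚ.*-monoʳ-≤ 3 u+v≤w+N ⟩
  3 * (w + N)     ≡⟨ ℕₚ.*-distribˡ-+ 3 w N ⟩
  3 * w + 3 * N   ∎)
  where
  open ℕₚ.≤-Reasoning
  N+3*N≡2*N+2*N : ∀ N → N + 3 * N ≡ 2 * N + 2 * N
  N+3*N≡2*N+2*N = solve-∀

allVecs-complete : ∀ n m (v : Vec (Fin m) n) → v ∈ allVecs n m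
allVecs-complete zero    m []      = here refl
allVecs-complete (suc n) m (x ∷ v) =
  ∈-cartesianProductWith⁺ _∷_ (∈-allFin x) (allVecs-complete n m v)

allVecs-unique : ∀ n m → Unique (allVecs n m)
allVecs-unique zero    m = [] ∷ []
allVecs-unique (suc n) m =
  Uniqueₚ.cartesianProductWith⁺ _∷_ Vecₚ.∷-injective (Uniqueₚ.allFin⁺ m) (allVecs-unique n m)

reindex : ∀ {A : Set} {n} → (Fin n → Fin n) → Vec A n → Vec A n
reindex τ v = tabulate (lookup v ∘ τ)

lookup-reindex : ∀ {A : Set} {n} (τ : Fin n → Fin n) (v : Vec A n) i →
                 lookup (reindex τ v) i ≡ lookup v (τ i)
lookup-reindex τ v = Vecₚ.lookup∘tabulate (lookup v ∘ τ)

reindex-injective : ∀ {A : Set} {n} {τ ρ : Fin n → Fin n} → (∀ y → τ (ρ y) ≡ y) →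
                    ∀ {v w : Vec A n} → reindex τ v ≡ reindex τ w → v ≡ w
reindex-injective {τ = τ} {ρ} τ∘ρ {v} {w} eq = begin
  v                   ≡⟨ Vecₚ.tabulate∘lookup v ⟨
  tabulate (lookup v) ≡⟨ Vecₚ.tabulate-cong lookups-agree ⟩
  tabulate (lookup w) ≡⟨ Vecₚ.tabulate∘lookup w ⟩
  w                   ∎
  where
  open ≡-Reasoning
  lookups-agree : ∀ y → lookup v y ≡ lookup w y
  lookups-agree y = begin
    lookup v y                  ≡⟨ cong (lookup v) (τ∘ρ y) ⟨
    lookup v (τ (ρ y))          ≡⟨ lookup-reindex τ v (ρ y) ⟨
    lookup (reindex τ v) (ρ y)  ≡⟨ cong (λ u → lookup u (ρ y)) eq ⟩
    lookup (reindex τ w) (ρ y)  ≡⟨ lookup-reindex τ w (ρ y) ⟩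
    lookup w (τ (ρ y))          ≡⟨ cong (lookup w) (τ∘ρ y) ⟩
    lookup w y                  ∎

-- On a finite poset a monotone bijection is automatically an automorphism,
-- so monotonicity is all that is asked for.
record IsAutomorphism {n} (P : FinPoset n) (τ : Fin n → Fin n) : Set where
  field
    bijective : Bijective _≡_ _≡_ τ
    monotone  : ∀ x y → _≼_ P x y → _≼_ P (τ x) (τ y)

antiAutomorphism²-isAutomorphism : ∀ {n} {P : FinPoset n} {σ : Fin n → Fin n} →
                                   IsAntiAutomorphism P σ → IsAutomorphism P (σ ∘ σ)
antiAutomorphism²-isAutomorphism {σ = σ} (σ-bij , σ-anti) = record
  { bijective = Compose.bijective _≡_ _≡_ _≡_ σ-bij σ-bij
  ; monotone  = λ x y x≼y → Equivalence.to (σ-anti (σ y) (σ x)) (Equivalence.to (σ-anti x y) x≼y)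
  }

module _ {n} {P : FinPoset n} {τ : Fin n → Fin n} (τ-aut : IsAutomorphism P τ) where
  open IsAutomorphism τ-aut

  automorphism-inverse : Fin n → Fin n
  automorphism-inverse y = proj₁ (surjective⇒strictlySurjective (proj₂ bijective) y)

  automorphism-inverseʳ : ∀ y → τ (automorphism-inverse y) ≡ y
  automorphism-inverseʳ y = proj₂ (surjective⇒strictlySurjective (proj₂ bijective) y)

  reindex-isLinExt : ∀ {v} → IsLinExt P v → IsLinExt P (reindex τ v)
  reindex-isLinExt {v} (v-inj , v-mono) =
    (λ x y eq → proj₁ bijective (v-inj (τ x) (τ y)
                  (trans (sym (lookup-reindex τ v x)) (trans eq (lookup-reindex τ v y))))) ,
    (λ x y x≼y → subst₂ _≤_ (cong toℕ (sym (lookup-reindex τ v x)))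
                             (cong toℕ (sym (lookup-reindex τ v y)))
                             (v-mono (τ x) (τ y) (monotone x y x≼y)))

module _ {n} (P : FinPoset n) where

  Before : Fin n → Fin n → Pred (Vec (Fin n) n) 0ℓ
  Before a b v = toℕ (lookup v a) < toℕ (lookup v b)

  before? : ∀ a b → Decidable (Before a b)
  before? a b v = toℕ (lookup v a) ℕₚ.<? toℕ (lookup v b)

  linExts-isLinExt : All (IsLinExt P) (linExts P)
  linExts-isLinExt = all-filter (isLinExt? P) (allVecs n n)

  linExts-unique : Unique (linExts P)
  linExts-unique = Uniqueₚ.filter⁺ (isLinExt? P) (allVecs-unique n n)

  isLinExt⇒∈linExts : ∀ {v} → IsLinExt P v → v ∈ linExts P
  isLinExt⇒∈linExts {v} = ∈-filter⁺ (isLinExt? P) (allVecs-complete n n v)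

  numBefore-irrefl : ∀ a → numBefore P a a ≡ 0
  numBefore-irrefl a = cong length (filter-none (before? a a)
                                      (All.universal (λ v → ℕₚ.<-irrefl refl) (linExts P)))

  numBefore-complement : ∀ {a b} → a ≢ b → numBefore P a b + numBefore P b a ≡ numLinExt P
  numBefore-complement {a} {b} a≢b =
    count-complement {P = Before a b} {Q = Before b a} (before? a b) (before? b a)
      (All.map (λ {v} → after⇔¬before v) linExts-isLinExt)
    where
    after⇔¬before : ∀ v → IsLinExt P v → (Before b a v ⇔ (¬ Before a b v))
    after⇔¬before v (v-inj , _) = mk⇔ ℕₚ.<⇒≯ λ a≮b →
      ℕₚ.≤∧≢⇒< (ℕₚ.≮⇒≥ a≮b) λ eq → a≢b (v-inj a b (toℕ-injective (sym eq)))

  numBefore-trans : ∀ a b c → numBefore P a b + numBefore P b c ≤ numBefore P a c + numLinExt P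
  numBefore-trans a b c =
    count-∩ {P = Before a b} {Q = Before b c} (before? a b) (before? b c)
            {R = Before a c} (before? a c) (λ _ → ℕₚ.<-trans) (linExts P)

  -- v ↦ v ∘ τ injects the extensions with τ a before τ b into those with a before b.
  numBefore-automorphism : ∀ {τ} → IsAutomorphism P τ → ∀ a b →
                           numBefore P (τ a) (τ b) ≤ numBefore P a b
  numBefore-automorphism {τ} τ-aut a b = begin
    length τ-ordered              ≡⟨ length-map (reindex τ) τ-ordered ⟨
    length (map (reindex τ) τ-ordered)
      ≤⟨ unique⊆⇒length≤
           (Uniqueₚ.map⁺ {f = reindex τ} (reindex-injective (automorphism-inverseʳ τ-aut))
                         (Uniqueₚ.filter⁺ (before? (τ a) (τ b)) linExts-unique))
           image⊆ ⟩
    numBefore P a b               ∎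
    where
    open ℕₚ.≤-Reasoning
    τ-ordered : List (Vec (Fin n) n)
    τ-ordered = filter (before? (τ a) (τ b)) (linExts P)

    image⊆ : map (reindex τ) τ-ordered ⊆ filter (before? a b) (linExts P)
    image⊆ w∈image with ∈-map⁻ (reindex τ) w∈image
    ... | v , v∈τ-ordered , refl with ∈-filter⁻ (before? (τ a) (τ b)) v∈τ-ordered
    ... | v∈linExts , τa<τb =
      ∈-filter⁺ (before? a b)
        (isLinExt⇒∈linExts (reindex-isLinExt τ-aut {v} (All.lookup linExts-isLinExt v∈linExts)))
        (subst₂ _<_ (cong toℕ (sym (lookup-reindex τ v a)))
                    (cong toℕ (sym (lookup-reindex τ v b))) τa<τb)

module _ {n} (P : FinPoset n) (unbalanced : ¬ OneThirdBalanced P) where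

  private
    N : ℕ
    N = numLinExt P

    nb : Fin n → Fin n → ℕ
    nb = numBefore P

  _⊏_ : Fin n → Fin n → Set
  a ⊏ b = 2 * N < 3 * nb a b

  ⊏-irrefl : ∀ a → ¬ a ⊏ a
  ⊏-irrefl a a⊏a = n≮0 (subst (λ k → 2 * N < 3 * k) (numBefore-irrefl P a) a⊏a)

  more-than-third⇒⊏ : ∀ {a b} → a ≢ b → N ≤ 3 * nb a b → a ⊏ b
  more-than-third⇒⊏ {a} {b} a≢b N≤3nb =
    ≰⇒> λ 3nb≤2N → unbalanced (a , b , a≢b , N≤3nb , 3nb≤2N)

  ⊏-total : ∀ {a b} → a ≢ b → a ⊏ b ⊎ b ⊏ a
  ⊏-total {a} {b} a≢b with N ℕₚ.≤? 3 * nb a b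
  ... | yes N≤3nb = inj₁ (more-than-third⇒⊏ a≢b N≤3nb)
  ... | no  N≰3nb =
    inj₂ (complement-of-minority (nb a b) (nb b a) N (numBefore-complement P a≢b) (≰⇒> N≰3nb))

  ⊏-trans : ∀ {a b c} → a ⊏ b → b ⊏ c → a ⊏ c
  ⊏-trans {a} {b} {c} a⊏b b⊏c = more-than-third⇒⊏ a≢c (<⇒≤ N<3nb)
    where
    N<3nb : N < 3 * nb a c
    N<3nb = majority-trans (nb a b) (nb b c) (nb a c) N a⊏b b⊏c (numBefore-trans P a b c)
    a≢c : a ≢ c
    a≢c refl = n≮0 (subst (λ k → N < 3 * k) (numBefore-irrefl P a) N<3nb)

  ⊏-reflected : ∀ {τ} → IsAutomorphism P τ → ∀ {a b} → τ a ⊏ τ b → a ⊏ b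
  ⊏-reflected τ-aut {a} {b} τa⊏τb =
    ℕₚ.<-≤-trans τa⊏τb (ℕₚ.*-monoʳ-≤ 3 (numBefore-automorphism P τ-aut a b))

  automorphism-trivial : ∀ {τ} → IsAutomorphism P τ → ∀ x → τ x ≡ x
  automorphism-trivial {τ} τ-aut x = decidable-stable (τ x ≟ x) λ τx≢x →
    [ no-ascending-orbit _⊏_ ⊏-irrefl ⊏-trans ρ ρ-mono x
    , no-ascending-orbit (flip _⊏_) ⊏-irrefl (flip ⊏-trans) ρ ρ-mono x
    ]′ (⊏-total λ x≡ρx → τx≢x (trans (cong τ x≡ρx) (τ∘ρ x)))
    where
    ρ : Fin n → Fin n
    ρ = automorphism-inverse τ-aut

    τ∘ρ : ∀ y → τ (ρ y) ≡ y
    τ∘ρ = automorphism-inverseʳ τ-aut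

    ρ-mono : ∀ {a b} → a ⊏ b → ρ a ⊏ ρ b
    ρ-mono {a} {b} a⊏b = ⊏-reflected τ-aut (subst₂ _⊏_ (sym (τ∘ρ a)) (sym (τ∘ρ b)) a⊏b)

oneThirdBalanced? : ∀ {n} (P : FinPoset n) → Dec (OneThirdBalanced P)
oneThirdBalanced? P = any? λ x → any? λ y →
  ¬? (x ≟ y) ×-dec (_ ℕₚ.≤? _) ×-dec (_ ℕₚ.≤? _)

corollary2p5 : (n : ℕ) (P : FinPoset n) (σ : Fin n → Fin n)
    → IsAntiAutomorphism P σ
    → ¬ (∀ x → σ (σ x) ≡ x)
    → OneThirdBalanced P
corollary2p5 n P σ σ-anti σ²≢id with oneThirdBalanced? P
... | yes balanced  = balanced
... | no unbalanced =
  contradiction (automorphism-trivial P unbalanced (antiAutomorphism²-isAutomorphism σ-anti)) σ²≢id
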